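{- Let $k\in\mathbb{R}$, $k>0$. For every integer $n\geq1$, $$j_{ -n}^{(3)}(k)=2J_{ -(n-1)}^{(3)}(k)+(1-k)J_{ -n}^{(3)}(k)+2J_{ -(n+1)}^{(3)}(k).$$
   Context: For $k>0$, the third-order $k$-Jacobsthal sequence $(J_n^{(3)}(k))$ is defined by $J_0^{(3)}(k)=0$, $J_1^{(3)}(k)=1$, $J_2^{(3)}(k)=k-1$, and the third-order $k$-Jacobsthal--Lucas sequence $(j_n^{(3)}(k))$ by $j_0^{(3)}(k)=2$, $j_1^{(3)}(k)=k-1$, $j_2^{(3)}(k)=k^2+1$; both satisfy $x_{n+3}=(k-1)x_{n+2}+(k-1)x_{n+1}+kx_{n}$. Both are extended to negative indices by requiring this recurrence to hold for all integers $n$, i.e. $x_{ -n}=\frac{1-k}{k}x_{ -(n-1)}+\frac{1-k}{k}x_{ -(n-2)}+\frac{1}{k}x_{ -(n-3)}$ for $n\geq1$. -}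

module Defs where

open import Level using (Level)
open import Data.Nat using (ℕ; zero; suc)
open import Data.Integer using (ℤ; +_; -[1+_])
open import Data.Product using (_×_; _,_; proj₁)
open import Algebra.Bundles using (CommutativeRing)

-- Third-order k-Jacobsthal(-Lucas) sequences, extended to all integer
-- indices, with values in a commutative ring R in which k is invertible
-- (kinv is the inverse of k; the paper's case is R = ℝ, k > 0).
module ThirdOrder {c ℓ : Level} (R : CommutativeRing c ℓ)
                  (k kinv : CommutativeRing.Carrier R) where
  open CommutativeRing R

  Triple : Set c
  Triple = Carrier × Carrier × Carrier

  two : Carrier
  two = 1# + 1#

  fstep : Triple → Triple
  fstep (x , y , z) = (y , z , ((k - 1#) * z + (k - 1#) * y) + k * x)

  bstep : Triple → Triple
  bstep (x , y , z) =
    ((((1# - k) * kinv) * x + ((1# - k) * kinv) * y) + kinv * z , x , y)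

  iter : (Triple → Triple) → ℕ → Triple → Triple
  iter f zero t = t
  iter f (suc n) t = iter f n (f t)

  seq : Carrier → Carrier → Carrier → ℤ → Carrier
  seq a b d (+ n)      = proj₁ (iter fstep n (a , b , d))
  seq a b d -[1+ n ]   = proj₁ (iter bstep (suc n) (a , b , d))

  J : ℤ → Carrier
  J = seq 0# 1# (k - 1#)

  jL : ℤ → Carrier
  jL = seq two (k - 1#) (k * k + 1#)

-- The backward step of the recurrence is a linear map on triples of
-- consecutive terms, and so is each of its iterates. The initial triple
-- (j₀, j₁, j₂) of the Lucas sequence equals 2·(J₁, J₂, J₃) + (1−k)·(J₀, J₁, J₂)
-- + 2·(J₋₁, J₀, J₁), an identity among polynomials in k. Applying the n-th
-- backward iterate to both sides and using that the backward step undoes the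
-- forward step (this is where k·k⁻¹ = 1 enters) gives the formula.
module Submission where

open import Defs
open import Level using (Level; _⊔_)
open import Data.Nat using (ℕ; zero; suc; _≤_; _∸_; s≤s)
open import Data.Integer using (+_) renaming (-_ to ℤ-)
open import Data.Product using (_,_; proj₁)
open import Data.Product.Relation.Binary.Pointwise.NonDependent
  using (Pointwise; ×-isEquivalence)
open import Function using (id)
open import Relation.Binary.Structures using (IsEquivalence)
open import Relation.Binary.PropositionalEquality as ≡ using (_≡_)
open import Algebra.Bundles using (CommutativeRing)
import Algebra.Solver.Ring.NaturalCoefficients.Default as NaturalCoefficients
import Relation.Binary.Reasoning.Setoid as SetoidReasoning

module _ {c ℓ : Level} (R : CommutativeRing c ℓ)
         (k kinv : CommutativeRing.Carrier R) where
  open CommutativeRing R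
  open ThirdOrder R k kinv
  open NaturalCoefficients commutativeSemiring using (solve; _:=_; _:+_; _:*_; con)

  infix 4 _≈₃_
  infixl 6 _⊕_
  infixr 7 _⊛_

  _≈₃_ : Triple → Triple → Set ℓ
  _≈₃_ = Pointwise _≈_ (Pointwise _≈_ _≈_)

  ≈₃-isEquivalence : IsEquivalence _≈₃_
  ≈₃-isEquivalence = ×-isEquivalence isEquivalence (×-isEquivalence isEquivalence isEquivalence)

  open IsEquivalence ≈₃-isEquivalence using ()
    renaming (refl to ≈₃-refl; sym to ≈₃-sym; trans to ≈₃-trans)

  _⊕_ : Triple → Triple → Triple
  (x , y , z) ⊕ (x′ , y′ , z′) = (x + x′ , y + y′ , z + z′)

  _⊛_ : Carrier → Triple → Triple
  α ⊛ (x , y , z) = (α * x , α * y , α * z)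

  ⊕-cong : ∀ {s s′ t t′} → s ≈₃ s′ → t ≈₃ t′ → s ⊕ t ≈₃ s′ ⊕ t′
  ⊕-cong (p , q , r) (p′ , q′ , r′) = +-cong p p′ , +-cong q q′ , +-cong r r′

  record IsLinear (f : Triple → Triple) : Set (c ⊔ ℓ) where
    field
      cong   : ∀ {s t} → s ≈₃ t → f s ≈₃ f t
      ⊕-homo : ∀ s t → f (s ⊕ t) ≈₃ f s ⊕ f t
      ⊛-homo : ∀ α t → f (α ⊛ t) ≈₃ α ⊛ f t

    combination₃-homo : ∀ α s β t γ u →
      f (α ⊛ s ⊕ β ⊛ t ⊕ γ ⊛ u) ≈₃ α ⊛ f s ⊕ β ⊛ f t ⊕ γ ⊛ f u
    combination₃-homo α s β t γ u =
      ≈₃-trans (⊕-homo (α ⊛ s ⊕ β ⊛ t) (γ ⊛ u))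
        (⊕-cong (≈₃-trans (⊕-homo (α ⊛ s) (β ⊛ t)) (⊕-cong (⊛-homo α s) (⊛-homo β t)))
                (⊛-homo γ u))

  iter-isLinear : ∀ {f} → IsLinear f → ∀ m → IsLinear (iter f m)
  iter-isLinear f-linear zero = record
    { cong   = id
    ; ⊕-homo = λ _ _ → ≈₃-refl
    ; ⊛-homo = λ _ _ → ≈₃-refl
    }
  iter-isLinear {f} f-linear (suc m) = record
    { cong   = λ s≈t → Iter.cong (F.cong s≈t)
    ; ⊕-homo = λ s t → ≈₃-trans (Iter.cong (F.⊕-homo s t)) (Iter.⊕-homo (f s) (f t))
    ; ⊛-homo = λ α t → ≈₃-trans (Iter.cong (F.⊛-homo α t)) (Iter.⊛-homo α (f t))
    }
    where
    module F    = IsLinear f-linear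
    module Iter = IsLinear (iter-isLinear f-linear m)

  bstep-isLinear : IsLinear bstep
  bstep-isLinear = record
    { cong   = λ { (p , q , r) → +-cong (+-cong (*-congˡ p) (*-congˡ q)) (*-congˡ r) , p , q }
    ; ⊕-homo = λ { (x , y , z) (x′ , y′ , z′) →
        solve 8 (λ C I x y z x′ y′ z′ →
          (C :* (x :+ x′) :+ C :* (y :+ y′)) :+ I :* (z :+ z′)
          := ((C :* x :+ C :* y) :+ I :* z) :+ ((C :* x′ :+ C :* y′) :+ I :* z′))
          refl ((1# - k) * kinv) kinv x y z x′ y′ z′
        , refl , refl }
    ; ⊛-homo = λ { α (x , y , z) →
        solve 6 (λ C I α x y z →
          (C :* (α :* x) :+ C :* (α :* y)) :+ I :* (α :* z)
          := α :* ((C :* x :+ C :* y) :+ I :* z))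
          refl ((1# - k) * kinv) kinv α x y z
        , refl , refl }
    }

  seq-negative : ∀ a b d m → seq a b d (ℤ- (+ m)) ≡ proj₁ (iter bstep m (a , b , d))
  seq-negative a b d zero    = ≡.refl
  seq-negative a b d (suc m) = ≡.refl

  -- The solver works over the commutative semiring, so subtraction is
  -- handled by proving each identity up to a multiple of (1 − k) + (k − 1).
  1-k+k-1≈0 : (1# - k) + (k - 1#) ≈ 0#
  1-k+k-1≈0 = trans (+-assoc 1# (- k) (k - 1#))
    (trans (+-congˡ (trans (sym (+-assoc (- k) k (- 1#)))
                           (trans (+-congʳ (-‿inverseˡ k)) (+-identityˡ (- 1#)))))
           (-‿inverseʳ 1#))

  k-1+1≈k : (k - 1#) + 1# ≈ k
  k-1+1≈k = trans (+-assoc k (- 1#) 1#) (trans (+-congˡ (-‿inverseˡ 1#)) (+-identityʳ k))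

  x+y*[1-k+k-1]≈x : ∀ x y → x + y * ((1# - k) + (k - 1#)) ≈ x
  x+y*[1-k+k-1]≈x x y =
    trans (+-congˡ (trans (*-congˡ 1-k+k-1≈0) (zeroʳ y))) (+-identityʳ x)

  J-initial : Triple
  J-initial = (0# , 1# , k - 1#)

  jL-initial : Triple
  jL-initial = (two , k - 1# , k * k + 1#)

  jL-initial-decomposition :
    jL-initial ≈₃ two ⊛ fstep J-initial ⊕ (1# - k) ⊛ J-initial ⊕ two ⊛ bstep J-initial
  jL-initial-decomposition = ≈₃-sym
    ( trans first (x+y*[1-k+k-1]≈x _ _)
    , trans second (x+y*[1-k+k-1]≈x _ _)
    , trans third (trans (x+y*[1-k+k-1]≈x _ _) (+-congʳ (*-cong k-1+1≈k k-1+1≈k))) )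
    where
    first : (two * 1# + (1# - k) * 0#)
              + two * ((((1# - k) * kinv) * 0# + ((1# - k) * kinv) * 1#) + kinv * (k - 1#))
            ≈ two + (two * kinv) * ((1# - k) + (k - 1#))
    first = solve 3 (λ M N I →
      ((con 2 :* con 1 :+ M :* con 0)
        :+ con 2 :* (((M :* I) :* con 0 :+ (M :* I) :* con 1) :+ I :* N))
      := con 2 :+ (con 2 :* I) :* (M :+ N)) refl (1# - k) (k - 1#) kinv
    second : (two * (k - 1#) + (1# - k) * 1#) + two * 0#
             ≈ (k - 1#) + 1# * ((1# - k) + (k - 1#))
    second = solve 2 (λ M N →
      (con 2 :* N :+ M :* con 1) :+ con 2 :* con 0
      := N :+ con 1 :* (M :+ N)) refl (1# - k) (k - 1#)
    third : (two * (((k - 1#) * (k - 1#) + (k - 1#) * 1#) + k * 0#) + (1# - k) * (k - 1#))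
              + two * 1#
            ≈ (((k - 1#) + 1#) * ((k - 1#) + 1#) + 1#) + (k - 1#) * ((1# - k) + (k - 1#))
    third = solve 3 (λ M N K →
      (con 2 :* ((N :* N :+ N :* con 1) :+ K :* con 0) :+ M :* N) :+ con 2 :* con 1
      := ((N :+ con 1) :* (N :+ con 1) :+ con 1) :+ N :* (M :+ N)) refl (1# - k) (k - 1#) k

  module _ (k*kinv≈1 : k * kinv ≈ 1#) where

    bstep-fstep : ∀ t → bstep (fstep t) ≈₃ t
    bstep-fstep (x , y , z) = trans expand (trans (x+y*[1-k+k-1]≈x _ _) x*k*kinv≈x) , refl , refl
      where
      expand : (((1# - k) * kinv) * y + ((1# - k) * kinv) * z)
                 + kinv * (((k - 1#) * z + (k - 1#) * y) + k * x)
               ≈ x * (k * kinv) + (kinv * (y + z)) * ((1# - k) + (k - 1#))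
      expand = solve 7 (λ M N K I x y z →
        ((M :* I) :* y :+ (M :* I) :* z) :+ I :* ((N :* z :+ N :* y) :+ K :* x)
        := x :* (K :* I) :+ (I :* (y :+ z)) :* (M :+ N)) refl (1# - k) (k - 1#) k kinv x y z
      x*k*kinv≈x : x * (k * kinv) ≈ x
      x*k*kinv≈x = trans (*-congˡ k*kinv≈1) (*-identityʳ x)

    jL-negative : ∀ m →
      jL (ℤ- (+ suc m)) ≈ two * J (ℤ- (+ m)) + (1# - k) * J (ℤ- (+ suc m)) + two * J (ℤ- (+ suc (suc m)))
    jL-negative m = begin
      jL (ℤ- (+ suc m))
        ≈⟨ proj₁ (Back.cong jL-initial-decomposition) ⟩
      proj₁ (back (two ⊛ fstep J-initial ⊕ (1# - k) ⊛ J-initial ⊕ two ⊛ bstep J-initial))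
        ≈⟨ proj₁ (Back.combination₃-homo two (fstep J-initial) (1# - k) J-initial two (bstep J-initial)) ⟩
      two * proj₁ (back (fstep J-initial)) + (1# - k) * proj₁ (back J-initial)
        + two * proj₁ (back (bstep J-initial))
        ≈⟨ +-congʳ (+-congʳ (*-congˡ (proj₁ (Iterate.cong (bstep-fstep J-initial))))) ⟩
      two * proj₁ (iter bstep m J-initial) + (1# - k) * J (ℤ- (+ suc m)) + two * J (ℤ- (+ suc (suc m)))
        ≡⟨ ≡.cong (λ Jₘ → two * Jₘ + (1# - k) * J (ℤ- (+ suc m)) + two * J (ℤ- (+ suc (suc m))))
                  (seq-negative 0# 1# (k - 1#) m) ⟨
      two * J (ℤ- (+ m)) + (1# - k) * J (ℤ- (+ suc m)) + two * J (ℤ- (+ suc (suc m))) ∎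
      where
      open SetoidReasoning setoid
      back : Triple → Triple
      back = iter bstep (suc m)
      module Back = IsLinear (iter-isLinear bstep-isLinear (suc m))
      module Iterate = IsLinear (iter-isLinear bstep-isLinear m)

theorem3p3 : {c ℓ : Level} (R : CommutativeRing c ℓ)
    (k kinv : CommutativeRing.Carrier R) →
    CommutativeRing._≈_ R (CommutativeRing._*_ R k kinv) (CommutativeRing.1# R) →
    (n : ℕ) → 1 ≤ n →
    let open CommutativeRing R
        open ThirdOrder R k kinv
    in jL (ℤ- (+ n)) ≈ ((two * J (ℤ- (+ (n ∸ 1))) + (1# - k) * J (ℤ- (+ n))) + two * J (ℤ- (+ suc n)))
theorem3p3 R k kinv k*kinv≈1 (suc m) (s≤s _) = jL-negative R k kinv k*kinv≈1 m
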